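{- Let $R$ be an $r$-vertex tournament with ${\rm inv}_2(R)=m$, let $n$ be a multiple of $r$, and let $Z$ be an $n$-vertex balanced blowup of $R$. Then for every permutation $\sigma$ of $V(Z)$, the graph $Z_L(\sigma)$ contains at least $mn^2/r^2$ outer edges.
   Context: ${\rm inv}_2(D)$ is the minimum number of edges of $D$ whose reversal makes $D$ acyclic. An $n$-vertex balanced blowup of $R$ is obtained by replacing each vertex $i$ of $R$ by a set $V_i$ of size $n/r$ (pairwise disjoint), orienting, for each edge $(i,j)$ of $R$, all edges from $V_i$ to $V_j$ (these are outer edges), and orienting the edges inside each $V_i$ arbitrarily (inner edges). For a digraph $D$ and a permutation $\sigma$ of $V(D)$, $D_L(\sigma)$ is the undirected graph on $V(D)$ with edge $\{i,j\}$ iff $(i,j)\in E(D)$ and $\sigma(i)<\sigma(j)$. -}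

module Defs where

open import Data.Nat using (ℕ; zero; suc; _+_; _*_; _≤_; _<_)
open import Data.Bool using (Bool; true; false; if_then_else_; _∧_; _∨_; not; T)
open import Data.Fin using (Fin; zero; suc; inject₁; fromℕ; toℕ; _≟_)
open import Data.Fin.Permutation using (Permutation′; _⟨$⟩ʳ_)
open import Data.List using (List; map)
open import Data.Nat.ListAction using (sum)
open import Data.List using () renaming (allFin to allFinL)
open import Data.Product using (Σ; _×_; ∃)
open import Relation.Binary.PropositionalEquality using (_≡_; _≢_)
open import Relation.Nullary using (¬_)
open import Relation.Nullary.Decidable using (⌊_⌋)

Digraph : ℕ → Set
Digraph k = Fin k → Fin k → Bool

IsTournament : ∀ {k} → Digraph k → Set
IsTournament {k} D =
  (∀ (i : Fin k) → D i i ≡ false) ×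
  (∀ (i j : Fin k) → i ≢ j → (D i j ∨ D j i ≡ true) × (D i j ∧ D j i ≡ false))

countPairs : ∀ {k} → (Fin k → Fin k → Bool) → ℕ
countPairs {k} f =
  sum (map (λ i → sum (map (λ j → if f i j then 1 else 0) (allFinL k))) (allFinL k))

countVerts : ∀ {k} → (Fin k → Bool) → ℕ
countVerts {k} f = sum (map (λ u → if f u then 1 else 0) (allFinL k))

-- A directed cycle, given as a closed directed walk of positive length
-- w 0 → w 1 → … → w l = w 0  (l ≥ 1).  A digraph has a directed cycle iff it
-- has a closed walk of positive length.
HasCycle : ∀ {k} → Digraph k → Set
HasCycle {k} D =
  Σ ℕ λ l → Σ (Fin (suc (suc l)) → Fin k) λ w →
    (∀ (i : Fin (suc l)) → D (w (inject₁ i)) (w (suc i)) ≡ true) ×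
    (w zero ≡ w (fromℕ (suc l)))

Acyclic : ∀ {k} → Digraph k → Set
Acyclic D = ¬ HasCycle D

SubsetOf : ∀ {k} → Digraph k → Digraph k → Set
SubsetOf {k} F D = ∀ (i j : Fin k) → F i j ≡ true → D i j ≡ true

reverseEdges : ∀ {k} → Digraph k → Digraph k → Digraph k
reverseEdges D F i j = (D i j ∧ not (F i j)) ∨ (D j i ∧ F j i)

Inv2 : ∀ {k} → Digraph k → ℕ → Set
Inv2 D m =
  (Σ _ λ F → SubsetOf F D × Acyclic (reverseEdges D F) × countPairs F ≡ m) ×
  (∀ F → SubsetOf F D → Acyclic (reverseEdges D F) → m ≤ countPairs F)

-- Z (on Fin n) is a balanced blowup of R (on Fin r) with parts V_i = part⁻¹(i),
-- each of size s = n / r.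
IsBalancedBlowup : ∀ {r n} → Digraph r → (s : ℕ) → Digraph n → (Fin n → Fin r) → Set
IsBalancedBlowup {r} {n} R s Z part =
  (∀ (i : Fin r) → countVerts (λ u → ⌊ part u ≟ i ⌋) ≡ s) ×
  (∀ (u v : Fin n) → part u ≢ part v → Z u v ≡ R (part u) (part v)) ×
  (∀ (u v : Fin n) → part u ≡ part v →
     ((u ≡ v → Z u v ≡ false) ×
      (u ≢ v → (Z u v ∨ Z v u ≡ true) × (Z u v ∧ Z v u ≡ false))))

-- number of outer edges of Z_L(σ): edges {u , v} with (u , v) ∈ E(Z),
-- σ(u) < σ(v), and u , v in different parts.
outerLeftEdges : ∀ {r n} → Digraph n → (Fin n → Fin r) → Permutation′ n → ℕ
outerLeftEdges Z part σ =
  countPairs (λ u v →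
    Z u v ∧ not ⌊ part u ≟ part v ⌋ ∧ ⌊ Data.Nat._<?_ (toℕ (σ ⟨$⟩ʳ u)) (toℕ (σ ⟨$⟩ʳ v)) ⌋)

module Submission where

-- Fix a transversal c, one vertex c i in each part V_i.  Reversing those edges (i , j) of R
-- with σ(c i) < σ(c j) leaves a digraph along which σ ∘ c strictly decreases, hence an acyclic
-- one; so at least m = inv₂(R) edges of R lift through c to left edges of Z.  Summing over all
-- s^r transversals counts every outer left edge of Z exactly s^(r-2) times, whence
-- s^(r-2) · #outer left edges ≥ m · s^r.  Sums over transversals are taken as sums over all
-- maps Fin r → Fin n weighted by the indicators of the parts.

open import Data.Bool using (Bool; true; false; if_then_else_; _∧_; not)
open import Data.Bool.Properties using (∧-zeroʳ)
open import Data.Empty using (⊥-elim)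
open import Data.Fin using (Fin; zero; suc; toℕ; inject₁; fromℕ; _≟_)
open import Data.Fin.Permutation using (Permutation′; _⟨$⟩ʳ_; _⟨$⟩ˡ_; inverseˡ)
open import Data.Fin.Properties using (toℕ-injective)
open import Data.List using (map; tabulate) renaming (allFin to allFinL)
open import Data.List.Properties using (map-tabulate)
open import Data.Nat using (ℕ; zero; suc; _+_; _*_; _^_; _≤_; _<_; _≮_; z≤n; s≤s; _<?_)
open import Data.Nat.ListAction using () renaming (sum to sumₗ)
open import Data.Nat.Properties hiding (_≟_)
open import Algebra.Properties.Semiring.Sum +-*-semiring
  using (sum-syntax; sum-cong-≗; sum-replicate-zero; ∑-comm; *-distribˡ-sum; *-distribʳ-sum; ∑-distrib-+)
open import Algebra.Properties.CommutativeSemigroup *-commutativeSemigroup using (x∙yz≈y∙xz; x∙yz≈z∙xy)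
open import Data.Nat.Tactic.RingSolver using (solve-∀)
open import Data.Product using (_×_; _,_; proj₁)
open import Data.Sum using (_⊎_; inj₁; inj₂)
open import Data.Vec.Functional using ([]; _∷_)
open import Function using (_∘_; id; const; flip)
open import Relation.Binary.PropositionalEquality
open import Relation.Nullary using (yes; no)
open import Relation.Nullary.Decidable using (⌊_⌋)

open import Defs

indicator : Bool → ℕ
indicator b = if b then 1 else 0

sumₗ-allFin : ∀ n (f : Fin n → ℕ) → sumₗ (map f (allFinL n)) ≡ ∑[ i < n ] f i
sumₗ-allFin n f = trans (cong sumₗ (map-tabulate id f)) (sumₗ-tabulate n)
  where
  sumₗ-tabulate : ∀ n {f : Fin n → ℕ} → sumₗ (tabulate f) ≡ ∑[ i < n ] f i
  sumₗ-tabulate zero = refl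
  sumₗ-tabulate (suc n) {f} = cong (f zero +_) (sumₗ-tabulate n)

countPairs≡∑∑ : ∀ {k} (f : Fin k → Fin k → Bool) →
                countPairs f ≡ ∑[ i < k ] ∑[ j < k ] indicator (f i j)
countPairs≡∑∑ {k} f =
  trans (sumₗ-allFin k (λ i → sumₗ (map (indicator ∘ f i) (allFinL k))))
        (sum-cong-≗ (λ i → sumₗ-allFin k (indicator ∘ f i)))

∑-mono-≤ : ∀ {n} {f g : Fin n → ℕ} → (∀ i → f i ≤ g i) → ∑[ i < n ] f i ≤ ∑[ i < n ] g i
∑-mono-≤ {zero} f≤g = z≤n
∑-mono-≤ {suc n} f≤g = +-mono-≤ (f≤g zero) (∑-mono-≤ (f≤g ∘ suc))

∑-indicator-≟ : ∀ {n} (p : Fin n) (h : Fin n → ℕ) → ∑[ i < n ] (indicator ⌊ p ≟ i ⌋ * h i) ≡ h p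
∑-indicator-≟ {suc n} zero h = begin
  1 * h zero + ∑[ i < n ] (0 * h (suc i)) ≡⟨ cong₂ _+_ (*-identityˡ (h zero)) (sum-replicate-zero n) ⟩
  h zero + 0                              ≡⟨ +-identityʳ (h zero) ⟩
  h zero                                  ∎
  where open ≡-Reasoning
∑-indicator-≟ {suc n} (suc p) h = trans (sum-cong-≗ shift) (∑-indicator-≟ p (h ∘ suc))
  where
  shift : ∀ i → indicator ⌊ suc p ≟ suc i ⌋ * h (suc i) ≡ indicator ⌊ p ≟ i ⌋ * h (suc i)
  shift i with p ≟ i
  ... | yes _ = refl
  ... | no _ = refl

pairSum : ∀ {N} (u v : Fin N → ℕ) → (Fin N → Fin N → ℕ) → ℕ
pairSum {N} u v f = ∑[ x < N ] ∑[ y < N ] (u x * v y * f x y)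

pairSum-flip : ∀ {N} (u v : Fin N → ℕ) (f : Fin N → Fin N → ℕ) → pairSum u v f ≡ pairSum v u (flip f)
pairSum-flip u v f =
  trans (∑-comm (λ x y → u x * v y * f x y))
        (sum-cong-≗ (λ y → sum-cong-≗ (λ x → cong (_* f x y) (*-comm (u x) (v y)))))

pairSum-zero : ∀ {N} (u v : Fin N → ℕ) → pairSum u v (λ _ _ → 0) ≡ 0
pairSum-zero {N} u v = trans (sum-cong-≗ (λ x → trans (sum-cong-≗ (λ y → *-zeroʳ (u x * v y)))
                                                      (sum-replicate-zero N)))
                             (sum-replicate-zero N)

-- weightedSum k w H = ∑ over all c : Fin k → Fin N of (∏ᵢ w i (c i)) * H c.
weightedSum : ∀ {N} k → (Fin k → Fin N → ℕ) → ((Fin k → Fin N) → ℕ) → ℕ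
weightedSum zero        w H = H []
weightedSum {N} (suc k) w H = ∑[ x < N ] (w zero x * weightedSum k (w ∘ suc) (H ∘ (x ∷_)))

module _ {N : ℕ} where

  weightedSum-zero : ∀ k (w : Fin k → Fin N → ℕ) → weightedSum k w (const 0) ≡ 0
  weightedSum-zero zero    w = refl
  weightedSum-zero (suc k) w =
    trans (sum-cong-≗ (λ x → trans (cong (w zero x *_) (weightedSum-zero k (w ∘ suc))) (*-zeroʳ (w zero x))))
          (sum-replicate-zero N)

  weightedSum-+ : ∀ k (w : Fin k → Fin N → ℕ) (H H′ : (Fin k → Fin N) → ℕ) →
                  weightedSum k w (λ c → H c + H′ c) ≡ weightedSum k w H + weightedSum k w H′
  weightedSum-+ zero    w H H′ = refl
  weightedSum-+ (suc k) w H H′ =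
    trans (sum-cong-≗ (λ x → trans (cong (w zero x *_) (weightedSum-+ k (w ∘ suc) (H ∘ (x ∷_)) (H′ ∘ (x ∷_))))
                                   (*-distribˡ-+ (w zero x) _ _)))
          (∑-distrib-+ (λ x → w zero x * weightedSum k (w ∘ suc) (H ∘ (x ∷_)))
                       (λ x → w zero x * weightedSum k (w ∘ suc) (H′ ∘ (x ∷_))))

  weightedSum-∑ : ∀ k (w : Fin k → Fin N → ℕ) {m} (H : Fin m → (Fin k → Fin N) → ℕ) →
                  weightedSum k w (λ c → ∑[ a < m ] H a c) ≡ ∑[ a < m ] weightedSum k w (H a)
  weightedSum-∑ k w {zero}  H = weightedSum-zero k w
  weightedSum-∑ k w {suc m} H =
    trans (weightedSum-+ k w (H zero) _) (cong (weightedSum k w (H zero) +_) (weightedSum-∑ k w (H ∘ suc)))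

  weightedSum-mono-on-support : ∀ k (w : Fin k → Fin N → ℕ) {H H′ : (Fin k → Fin N) → ℕ} →
                                (∀ c → (∀ i → w i (c i) ≢ 0) → H c ≤ H′ c) →
                                weightedSum k w H ≤ weightedSum k w H′
  weightedSum-mono-on-support zero    w H≤H′ = H≤H′ [] (λ ())
  weightedSum-mono-on-support (suc k) w {H} {H′} H≤H′ = ∑-mono-≤ termwise
    where
    termwise : ∀ x → w zero x * weightedSum k (w ∘ suc) (H ∘ (x ∷_))
                   ≤ w zero x * weightedSum k (w ∘ suc) (H′ ∘ (x ∷_))
    termwise x with w zero x in wx
    ... | zero  = z≤n
    ... | suc n = *-monoʳ-≤ (suc n) (weightedSum-mono-on-support k (w ∘ suc) (λ c support →
                    H≤H′ (x ∷ c) λ { zero → λ wx≡0 → 0≢1+n (trans (sym wx≡0) wx) ; (suc i) → support i }))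

HasRowSums : ∀ {k N} → (Fin k → Fin N → ℕ) → ℕ → Set
HasRowSums {k} {N} w s = ∀ i → ∑[ x < N ] w i x ≡ s

module _ {N s : ℕ} where

  weightedSum-suc-uniform : ∀ k (w : Fin (suc k) → Fin N → ℕ) → ∑[ x < N ] w zero x ≡ s →
                            ∀ {H A} → (∀ x → weightedSum k (w ∘ suc) (H ∘ (x ∷_)) ≡ A) →
                            weightedSum (suc k) w H ≡ s * A
  weightedSum-suc-uniform k w row {H} {A} uniform =
    trans (sum-cong-≗ (λ x → cong (w zero x *_) (uniform x)))
          (trans (sym (*-distribʳ-sum A (w zero))) (cong (_* A) row))

  weightedSum-const : ∀ k (w : Fin k → Fin N → ℕ) → HasRowSums w s →
                      ∀ a → weightedSum k w (const a) ≡ a * s ^ k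
  weightedSum-const zero    w rows a = sym (*-identityʳ a)
  weightedSum-const (suc k) w rows a =
    trans (weightedSum-suc-uniform k w (rows zero) {const a} (λ _ → weightedSum-const k (w ∘ suc) (rows ∘ suc) a))
          (x∙yz≈y∙xz s a (s ^ k))

  weightedSum-single : ∀ k (w : Fin (suc k) → Fin N → ℕ) → HasRowSums w s →
                       (g : Fin N → ℕ) (j : Fin (suc k)) →
                       weightedSum (suc k) w (λ c → g (c j)) ≡ s ^ k * ∑[ x < N ] (w j x * g x)
  weightedSum-single k w rows g zero = begin
    ∑[ x < N ] (w zero x * weightedSum k (w ∘ suc) (const (g x)))
      ≡⟨ sum-cong-≗ (λ x → cong (w zero x *_) (weightedSum-const k (w ∘ suc) (rows ∘ suc) (g x))) ⟩
    ∑[ x < N ] (w zero x * (g x * s ^ k))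
      ≡⟨ sum-cong-≗ (λ x → x∙yz≈z∙xy (w zero x) (g x) (s ^ k)) ⟩
    ∑[ x < N ] (s ^ k * (w zero x * g x))
      ≡⟨ *-distribˡ-sum (s ^ k) (λ x → w zero x * g x) ⟨
    s ^ k * ∑[ x < N ] (w zero x * g x) ∎
    where open ≡-Reasoning
  weightedSum-single (suc k) w rows g (suc j) =
    trans (weightedSum-suc-uniform (suc k) w (rows zero) {λ c → g (c (suc j))}
             (λ _ → weightedSum-single k (w ∘ suc) (rows ∘ suc) g j))
          (sym (*-assoc s (s ^ k) _))

  weightedSum-pair : ∀ k (w : Fin (2 + k) → Fin N → ℕ) → HasRowSums w s →
                     (f : Fin N → Fin N → ℕ) (i j : Fin (2 + k)) → i ≢ j →
                     weightedSum (2 + k) w (λ c → f (c i) (c j)) ≡ s ^ k * pairSum (w i) (w j) f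
  weightedSum-pair k w rows f zero zero i≢j = ⊥-elim (i≢j refl)
  weightedSum-pair k w rows f zero (suc j) _ = begin
    ∑[ x < N ] (w zero x * weightedSum (suc k) (w ∘ suc) (λ c → f x (c j)))
      ≡⟨ sum-cong-≗ (λ x → cong (w zero x *_) (weightedSum-single k (w ∘ suc) (rows ∘ suc) (f x) j)) ⟩
    ∑[ x < N ] (w zero x * (s ^ k * ∑[ y < N ] (w (suc j) y * f x y)))
      ≡⟨ sum-cong-≗ (λ x → x∙yz≈y∙xz (w zero x) (s ^ k) _) ⟩
    ∑[ x < N ] (s ^ k * (w zero x * ∑[ y < N ] (w (suc j) y * f x y)))
      ≡⟨ *-distribˡ-sum (s ^ k) (λ x → w zero x * ∑[ y < N ] (w (suc j) y * f x y)) ⟨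
    s ^ k * ∑[ x < N ] (w zero x * ∑[ y < N ] (w (suc j) y * f x y))
      ≡⟨ cong (s ^ k *_) (sum-cong-≗ (λ x → *-distribˡ-sum (w zero x) (λ y → w (suc j) y * f x y))) ⟩
    s ^ k * ∑[ x < N ] ∑[ y < N ] (w zero x * (w (suc j) y * f x y))
      ≡⟨ cong (s ^ k *_) (sum-cong-≗ (λ x → sum-cong-≗ (λ y → *-assoc (w zero x) (w (suc j) y) (f x y)))) ⟨
    s ^ k * pairSum (w zero) (w (suc j)) f ∎
    where open ≡-Reasoning
  weightedSum-pair k w rows f (suc i) zero i≢j =
    trans (weightedSum-pair k w rows (flip f) zero (suc i) (i≢j ∘ sym))
          (cong (s ^ k *_) (sym (pairSum-flip (w (suc i)) (w zero) f)))
  weightedSum-pair zero w rows f (suc zero) (suc zero) i≢j = ⊥-elim (i≢j refl)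
  weightedSum-pair (suc k) w rows f (suc i) (suc j) i≢j =
    trans (weightedSum-suc-uniform (2 + k) w (rows zero) {λ c → f (c (suc i)) (c (suc j))}
             (λ _ → weightedSum-pair k (w ∘ suc) (rows ∘ suc) f i j (i≢j ∘ cong suc)))
          (sym (*-assoc s (s ^ k) _))

descending-walk : ∀ l (f : Fin (2 + l) → ℕ) → (∀ i → f (suc i) < f (inject₁ i)) → f (fromℕ (suc l)) < f zero
descending-walk zero    f desc = desc zero
descending-walk (suc l) f desc = <-trans (desc (fromℕ (suc l))) (descending-walk l (f ∘ inject₁) (desc ∘ inject₁))

acyclic-by-potential : ∀ {k} (D : Digraph k) (φ : Fin k → ℕ) →
                       (∀ i j → D i j ≡ true → φ j < φ i) → Acyclic D
acyclic-by-potential D φ desc (l , walk , edges , closed) =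
  <-irrefl (cong φ (sym closed)) (descending-walk l (φ ∘ walk) (λ t → desc _ _ (edges t)))

reverseEdges-true : ∀ {k} (D F : Digraph k) i j → reverseEdges D F i j ≡ true →
                    (D i j ≡ true × F i j ≡ false) ⊎ F j i ≡ true
reverseEdges-true D F i j rev with D i j | F i j | D j i | F j i
... | true  | false | _     | _     = inj₁ (refl , refl)
... | _     | _     | _     | true  = inj₂ refl
reverseEdges-true D F i j () | true  | true  | true  | false
reverseEdges-true D F i j () | true  | true  | false | false
reverseEdges-true D F i j () | false | _     | true  | false
reverseEdges-true D F i j () | false | _     | false | false

⌊<?⌋-true : ∀ {m n} → ⌊ m <? n ⌋ ≡ true → m < n
⌊<?⌋-true {m} {n} _ with m <? n
... | yes m<n = m<n
⌊<?⌋-true () | no _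

⌊<?⌋-false : ∀ {m n} → ⌊ m <? n ⌋ ≡ false → m ≮ n
⌊<?⌋-false {m} {n} _ with m <? n
... | no m≮n = m≮n
⌊<?⌋-false () | yes _

forwardEdges : ∀ {k} → Digraph k → (Fin k → ℕ) → Digraph k
forwardEdges D κ i j = D i j ∧ ⌊ κ i <? κ j ⌋

acyclic-reverse-forwardEdges : ∀ {k} (D : Digraph k) (κ : Fin k → ℕ) →
                               (∀ i j → D i j ≡ true → κ i ≢ κ j) →
                               Acyclic (reverseEdges D (forwardEdges D κ))
acyclic-reverse-forwardEdges D κ κ-separates = acyclic-by-potential _ κ descends
  where
  ∧-trueʳ : ∀ a {b} → a ∧ b ≡ true → b ≡ true
  ∧-trueʳ true  e  = e
  ∧-trueʳ false ()

  descends : ∀ i j → reverseEdges D (forwardEdges D κ) i j ≡ true → κ j < κ i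
  descends i j rev with reverseEdges-true D (forwardEdges D κ) i j rev
  ... | inj₂ Fji         = ⌊<?⌋-true (∧-trueʳ (D j i) Fji)
  ... | inj₁ (Dij , Fij) = ≤∧≢⇒< (≮⇒≥ (⌊<?⌋-false (trans (cong (_∧ _) (sym Dij)) Fij)))
                                 (≢-sym (κ-separates i j Dij))

Loopless : ∀ {k} → Digraph k → Set
Loopless {k} D = ∀ (i : Fin k) → D i i ≡ false

module Blowup {r N : ℕ} (R : Digraph r) (part : Fin N → Fin r) (σ : Permutation′ N) where

  key : Fin N → ℕ
  key x = toℕ (σ ⟨$⟩ʳ x)

  key-injective : ∀ {x y} → key x ≡ key y → x ≡ y
  key-injective {x} {y} eq = begin
    x                          ≡⟨ inverseˡ σ ⟨
    σ ⟨$⟩ˡ (σ ⟨$⟩ʳ x)          ≡⟨ cong (σ ⟨$⟩ˡ_) (toℕ-injective eq) ⟩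
    σ ⟨$⟩ˡ (σ ⟨$⟩ʳ y)          ≡⟨ inverseˡ σ ⟩
    y                          ∎
    where open ≡-Reasoning

  partWeight : Fin r → Fin N → ℕ
  partWeight i x = indicator ⌊ part x ≟ i ⌋

  partWeight-support : ∀ i x → partWeight i x ≢ 0 → part x ≡ i
  partWeight-support i x nonzero with part x ≟ i
  ... | yes px≡i = px≡i
  ... | no _     = ⊥-elim (nonzero refl)

  liftedLeftEdge : Fin r → Fin r → Fin N → Fin N → ℕ
  liftedLeftEdge i j x y = indicator (R i j ∧ ⌊ key x <? key y ⌋)

  leftEdges : (Fin r → Fin N) → ℕ
  leftEdges c = ∑[ i < r ] ∑[ j < r ] liftedLeftEdge i j (c i) (c j)

  inv₂≤leftEdges : ∀ {m} → Loopless R → Inv2 R m →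
                   ∀ c → (∀ i → part (c i) ≡ i) → m ≤ leftEdges c
  inv₂≤leftEdges {m} loopless (_ , minimal) c transversal =
    subst (m ≤_) (countPairs≡∑∑ (forwardEdges R (key ∘ c)))
          (minimal _ (λ i j → ∧-trueˡ (R i j)) (acyclic-reverse-forwardEdges R (key ∘ c) separates))
    where
    ∧-trueˡ : ∀ a {b} → a ∧ b ≡ true → a ≡ true
    ∧-trueˡ true  _  = refl
    ∧-trueˡ false ()

    separates : ∀ i j → R i j ≡ true → key (c i) ≢ key (c j)
    separates i j Rij keys≡
      with trans (sym (transversal i)) (trans (cong part (key-injective keys≡)) (transversal j))
    ... | refl with trans (sym Rij) (loopless i)
    ... | ()

  partWeight-rowSums : ∀ {s Z} → IsBalancedBlowup R s Z part → HasRowSums partWeight s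
  partWeight-rowSums blowup i = trans (sym (sumₗ-allFin N (partWeight i))) (proj₁ blowup i)

  inv₂*s^r≤weightedSum-leftEdges : ∀ {m s} → Loopless R → Inv2 R m → HasRowSums partWeight s →
                                   m * s ^ r ≤ weightedSum r partWeight leftEdges
  inv₂*s^r≤weightedSum-leftEdges {m} loopless inv₂ rows =
    subst (_≤ weightedSum r partWeight leftEdges) (weightedSum-const r partWeight rows m)
          (weightedSum-mono-on-support r partWeight (λ c support →
             inv₂≤leftEdges loopless inv₂ c (λ i → partWeight-support i (c i) (support i))))

  ∑∑-pairSum-partWeight : (G : Fin r → Fin r → Fin N → Fin N → ℕ) →
                          ∑[ i < r ] ∑[ j < r ] pairSum (partWeight i) (partWeight j) (G i j)
                            ≡ ∑[ x < N ] ∑[ y < N ] G (part x) (part y) x y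
  ∑∑-pairSum-partWeight G = begin
    ∑[ i < r ] ∑[ j < r ] ∑[ x < N ] ∑[ y < N ] term i j x y
      ≡⟨ sum-cong-≗ (λ i → ∑-comm (λ j x → ∑[ y < N ] term i j x y)) ⟩
    ∑[ i < r ] ∑[ x < N ] ∑[ j < r ] ∑[ y < N ] term i j x y
      ≡⟨ ∑-comm (λ i x → ∑[ j < r ] ∑[ y < N ] term i j x y) ⟩
    ∑[ x < N ] ∑[ i < r ] ∑[ j < r ] ∑[ y < N ] term i j x y
      ≡⟨ sum-cong-≗ (λ x → sum-cong-≗ (λ i → ∑-comm (λ j y → term i j x y))) ⟩
    ∑[ x < N ] ∑[ i < r ] ∑[ y < N ] ∑[ j < r ] term i j x y
      ≡⟨ sum-cong-≗ (λ x → ∑-comm (λ i y → ∑[ j < r ] term i j x y)) ⟩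
    ∑[ x < N ] ∑[ y < N ] ∑[ i < r ] ∑[ j < r ] term i j x y
      ≡⟨ sum-cong-≗ (λ x → sum-cong-≗ (λ y → collapse x y)) ⟩
    ∑[ x < N ] ∑[ y < N ] G (part x) (part y) x y ∎
    where
    open ≡-Reasoning
    term : Fin r → Fin r → Fin N → Fin N → ℕ
    term i j x y = partWeight i x * partWeight j y * G i j x y

    collapse : ∀ x y → ∑[ i < r ] ∑[ j < r ] term i j x y ≡ G (part x) (part y) x y
    collapse x y = begin
      ∑[ i < r ] ∑[ j < r ] term i j x y
        ≡⟨ sum-cong-≗ (λ i → sum-cong-≗ (λ j → *-assoc (partWeight i x) (partWeight j y) (G i j x y))) ⟩
      ∑[ i < r ] ∑[ j < r ] (partWeight i x * (partWeight j y * G i j x y))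
        ≡⟨ sum-cong-≗ (λ i → *-distribˡ-sum (partWeight i x) (λ j → partWeight j y * G i j x y)) ⟨
      ∑[ i < r ] (partWeight i x * ∑[ j < r ] (partWeight j y * G i j x y))
        ≡⟨ sum-cong-≗ (λ i → cong (partWeight i x *_) (∑-indicator-≟ (part y) (λ j → G i j x y))) ⟩
      ∑[ i < r ] (partWeight i x * G i (part y) x y)
        ≡⟨ ∑-indicator-≟ (part x) (λ i → G i (part y) x y) ⟩
      G (part x) (part y) x y ∎

  outerLeftEdges≡∑∑liftedLeftEdge : ∀ {s Z} → Loopless R → IsBalancedBlowup R s Z part →
                                    outerLeftEdges Z part σ ≡ ∑[ x < N ] ∑[ y < N ] liftedLeftEdge (part x) (part y) x y
  outerLeftEdges≡∑∑liftedLeftEdge {Z = Z} loopless (_ , outer , _) =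
    trans (countPairs≡∑∑ (λ x y → Z x y ∧ not ⌊ part x ≟ part y ⌋ ∧ ⌊ key x <? key y ⌋))
          (sum-cong-≗ (λ x → sum-cong-≗ (λ y → cong indicator (outerEdge x y ⌊ key x <? key y ⌋))))
    where
    outerEdge : ∀ x y b → (Z x y ∧ not ⌊ part x ≟ part y ⌋ ∧ b) ≡ (R (part x) (part y) ∧ b)
    outerEdge x y b with part x ≟ part y
    ... | yes px≡py = trans (∧-zeroʳ (Z x y)) (sym (cong (_∧ b) (trans (cong (R (part x)) (sym px≡py)) (loopless (part x)))))
    ... | no  px≢py = cong (_∧ b) (outer x y px≢py)

module _ {k N : ℕ} (R : Digraph (2 + k)) (part : Fin N → Fin (2 + k)) (σ : Permutation′ N) where
  open Blowup R part σ

  weightedSum-liftedLeftEdge : ∀ {s} → Loopless R → HasRowSums partWeight s → ∀ i j →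
                               weightedSum (2 + k) partWeight (λ c → liftedLeftEdge i j (c i) (c j))
                                 ≡ s ^ k * pairSum (partWeight i) (partWeight j) (liftedLeftEdge i j)
  weightedSum-liftedLeftEdge {s} loopless rows i j with i ≟ j
  ... | no i≢j = weightedSum-pair k partWeight rows (liftedLeftEdge i j) i j i≢j
  ... | yes refl rewrite loopless i =
    trans (weightedSum-zero (2 + k) partWeight)
          (sym (trans (cong (s ^ k *_) (pairSum-zero (partWeight i) (partWeight i))) (*-zeroʳ (s ^ k))))

  weightedSum-leftEdges : ∀ {s} → Loopless R → HasRowSums partWeight s →
                          weightedSum (2 + k) partWeight leftEdges
                            ≡ s ^ k * ∑[ x < N ] ∑[ y < N ] liftedLeftEdge (part x) (part y) x y
  weightedSum-leftEdges {s} loopless rows = begin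
    weightedSum (2 + k) partWeight leftEdges
      ≡⟨ weightedSum-∑ (2 + k) partWeight (λ i c → ∑[ j < 2 + k ] edge i j c) ⟩
    ∑[ i < 2 + k ] weightedSum (2 + k) partWeight (λ c → ∑[ j < 2 + k ] edge i j c)
      ≡⟨ sum-cong-≗ (λ i → weightedSum-∑ (2 + k) partWeight (edge i)) ⟩
    ∑[ i < 2 + k ] ∑[ j < 2 + k ] weightedSum (2 + k) partWeight (edge i j)
      ≡⟨ sum-cong-≗ (λ i → sum-cong-≗ (weightedSum-liftedLeftEdge loopless rows i)) ⟩
    ∑[ i < 2 + k ] ∑[ j < 2 + k ] (s ^ k * pairSum′ i j)
      ≡⟨ sum-cong-≗ (λ i → *-distribˡ-sum (s ^ k) (pairSum′ i)) ⟨
    ∑[ i < 2 + k ] (s ^ k * ∑[ j < 2 + k ] pairSum′ i j)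
      ≡⟨ *-distribˡ-sum (s ^ k) (λ i → ∑[ j < 2 + k ] pairSum′ i j) ⟨
    s ^ k * ∑[ i < 2 + k ] ∑[ j < 2 + k ] pairSum′ i j
      ≡⟨ cong (s ^ k *_) (∑∑-pairSum-partWeight liftedLeftEdge) ⟩
    s ^ k * ∑[ x < N ] ∑[ y < N ] liftedLeftEdge (part x) (part y) x y ∎
    where
    open ≡-Reasoning
    edge : Fin (2 + k) → Fin (2 + k) → (Fin (2 + k) → Fin N) → ℕ
    edge i j c = liftedLeftEdge i j (c i) (c j)

    pairSum′ : Fin (2 + k) → Fin (2 + k) → ℕ
    pairSum′ i j = pairSum (partWeight i) (partWeight j) (liftedLeftEdge i j)

m*s^[2+k]≤s^k*n⇒m*s*s≤n : ∀ m s k n → m * s ^ (2 + k) ≤ s ^ k * n → m * s * s ≤ n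
m*s^[2+k]≤s^k*n⇒m*s*s≤n m zero    k n _ rewrite *-zeroʳ m = z≤n
m*s^[2+k]≤s^k*n⇒m*s*s≤n m s@(suc _) k n m*s^[2+k]≤s^k*n =
  *-cancelˡ-≤ (s ^ k) {{m^n≢0 s k}} (subst (_≤ s ^ k * n) (regroup m s (s ^ k)) m*s^[2+k]≤s^k*n)
  where
  regroup : ∀ m s t → m * (s * (s * t)) ≡ t * (m * s * s)
  regroup = solve-∀

inv₂≡0-of-≤1-vertex : ∀ {r m} (R : Digraph r) → r ≤ 1 → Loopless R → Inv2 R m → m ≡ 0
inv₂≡0-of-≤1-vertex R z≤n       loopless ((_ , _ , _ , |F|≡m) , _) = sym |F|≡m
inv₂≡0-of-≤1-vertex R (s≤s z≤n) loopless ((F , F⊆R , _ , |F|≡m) , _) with F zero zero in F00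
... | false = sym |F|≡m
... | true  with trans (sym (F⊆R zero zero F00)) (loopless zero)
...   | ()

lemma4p2 : (r s m : ℕ) (R : Digraph r) → IsTournament R → Inv2 R m →
           (Z : Digraph (r * s)) (part : Fin (r * s) → Fin r) →
           IsBalancedBlowup R s Z part →
           (σ : Permutation′ (r * s)) →
           m * s * s ≤ outerLeftEdges Z part σ
lemma4p2 zero s m R (loopless , _) inv₂ Z part blowup σ
  rewrite inv₂≡0-of-≤1-vertex R z≤n loopless inv₂ = z≤n
lemma4p2 (suc zero) s m R (loopless , _) inv₂ Z part blowup σ
  rewrite inv₂≡0-of-≤1-vertex R (s≤s z≤n) loopless inv₂ = z≤n
lemma4p2 r@(suc (suc k)) s m R (loopless , _) inv₂ Z part blowup σ =
  m*s^[2+k]≤s^k*n⇒m*s*s≤n m s k (outerLeftEdges Z part σ) (begin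
    m * s ^ r
      ≤⟨ inv₂*s^r≤weightedSum-leftEdges loopless inv₂ rows ⟩
    weightedSum r partWeight leftEdges
      ≡⟨ weightedSum-leftEdges R part σ loopless rows ⟩
    s ^ k * ∑[ x < r * s ] ∑[ y < r * s ] liftedLeftEdge (part x) (part y) x y
      ≡⟨ cong (s ^ k *_) (outerLeftEdges≡∑∑liftedLeftEdge loopless blowup) ⟨
    s ^ k * outerLeftEdges Z part σ ∎)
  where
  open Blowup R part σ
  open ≤-Reasoning
  rows : HasRowSums partWeight s
  rows = partWeight-rowSums blowup
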